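{- Let $2\le s\le s'$ be integers, let $G=(V,E)$ be a $K_{s,s'}$-free graph, and let $X\subseteq V$ satisfy $e(X,V\setminus X)\ge d|X|$ for some $d>0$. Then $|N(X)|\ge \frac{d|X|}{s'}$ if $|X|\le d^{1/(s-1)}$, and $|N(X)|\ge \frac{d^{s/(s-1)}}{s'}$ otherwise.
   Context: All graphs are finite, simple. $K_{s,s'}$ is the complete bipartite graph with parts of sizes $s$ and $s'$; $G$ is $K_{s,s'}$-free if it has no subgraph isomorphic to it. $e(X,Y)$ is the number of edges between disjoint sets $X,Y$, and $N(X)$ is the set of vertices outside $X$ with a neighbor in $X$.
   Formalization: The parameter d ranges over the positive rationals. -}

module Defs where

open import Data.Nat using (ℕ; zero; suc; _+_)
open import Data.Bool using (Bool; true; false; not; _∧_; _∨_; if_then_else_)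
open import Data.Fin using (Fin)
open import Data.List using (List; map; allFin; foldr)
open import Data.Nat.ListAction using (sum)
import Data.Integer as ℤ
open import Data.Product using (Σ; _×_; _,_)
open import Function.Definitions using (Injective)
open import Relation.Binary.PropositionalEquality using (_≡_; _≢_)
open import Relation.Nullary using (¬_)
import Data.Rational as ℚ

record Graph (n : ℕ) : Set where
  field
    adj    : Fin n → Fin n → Bool
    sym    : ∀ u v → adj u v ≡ adj v u
    irrefl : ∀ v → adj v v ≡ false
open Graph public

VSet : ℕ → Set
VSet n = Fin n → Bool

count : {n : ℕ} → (Fin n → Bool) → ℕ
count {n} p = sum (map (λ v → if p v then 1 else 0) (allFin n))

anyV : {n : ℕ} → (Fin n → Bool) → Bool
anyV {n} p = foldr (λ v b → p v ∨ b) false (allFin n)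

card : {n : ℕ} → VSet n → ℕ
card X = count X

eOut : {n : ℕ} → Graph n → VSet n → ℕ
eOut {n} G X = sum (map (λ u → count (λ v → X u ∧ (not (X v) ∧ adj G u v))) (allFin n))

Nbhd : {n : ℕ} → Graph n → VSet n → VSet n
Nbhd G X v = not (X v) ∧ anyV (λ u → X u ∧ adj G u v)

ContainsKss : {n : ℕ} → Graph n → ℕ → ℕ → Set
ContainsKss {n} G s s' =
  Σ (Fin s → Fin n) λ a → Σ (Fin s' → Fin n) λ b →
    Injective _≡_ _≡_ a × Injective _≡_ _≡_ b ×
    (∀ i j → a i ≢ b j) × (∀ i j → adj G (a i) (b j) ≡ true)

KssFree : {n : ℕ} → Graph n → ℕ → ℕ → Set
KssFree G s s' = ¬ ContainsKss G s s'

_^ℚ_ : ℚ.ℚ → ℕ → ℚ.ℚ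
q ^ℚ zero = ℚ.1ℚ
q ^ℚ suc k = q ℚ.* (q ^ℚ k)

ℕ→ℚ : ℕ → ℚ.ℚ
ℕ→ℚ m = ℤ.+ m ℚ./ 1

module Submission where

-- Write x = |X|, e = e(X, V ∖ X), m = |N(X)| and deg(y) = |N(y) ∩ X|, so
-- that e = Σ_{y ∈ N(X)} deg(y).  A discrete Jensen inequality for falling
--    factorials, proved from Chebyshev's sum inequality, bounds
--    Σ_y deg(y)_s below by Π_{i<s}(e - i·m)/m^{s-1}.  Combined with a bound
--    Σ_y deg(y)_s ≤ (s'-1)·x_s this gives e^s ≤ x^s (s'm)^{s-1} whenever
--    e > s'm; hence x^s ≤ e forces e ≤ s'm, and e ≤ x^s forces
--    e^s ≤ x^s (s'm)^{s-1}.
--  * Counting.  An injective s-tuple of X has at most s'-1 common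
--    neighbours outside X, so double counting (tuple, common neighbour)
--    pairs yields Σ_{y ∈ N(X)} deg(y)_s ≤ (s'-1)·x_s.
--  * Rationals.

module Inequalities where

  open import Data.Nat
  open import Data.Nat.Properties
  open import Data.Nat.Tactic.RingSolver using (solve-∀)
  open import Data.Nat.Combinatorics.Base using (_P′_)
  open import Data.Fin using (Fin; zero; suc)
  open import Data.Product using (_,_)
  open import Data.Sum using (inj₁; inj₂)
  open import Function using (_∘_)
  open import Relation.Binary.PropositionalEquality
  open import Relation.Nullary using (yes; no; contradiction)
  open import Algebra.Properties.Semiring.Sum +-*-semiring
    using (sum; sum-cong-≗; ∑-distrib-+; ∑-comm; *-distribˡ-sum; *-distribʳ-sum)
  open import Algebra.Properties.CommutativeSemigroup *-commutativeSemigroup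
    using (interchange; x∙yz≈y∙xz)

  sum-mono-≤ : ∀ {n} {f g : Fin n → ℕ} → (∀ i → f i ≤ g i) → sum f ≤ sum g
  sum-mono-≤ {zero}  f≤g = z≤n
  sum-mono-≤ {suc n} f≤g = +-mono-≤ (f≤g zero) (sum-mono-≤ (f≤g ∘ suc))

  weighted-sum-zero : ∀ {n} (w f : Fin n → ℕ) → sum w ≡ 0 → sum (λ i → w i * f i) ≡ 0
  weighted-sum-zero {zero}  w f _ = refl
  weighted-sum-zero {suc n} w f Σw≡0 with w zero | Σw≡0
  ... | zero | Σw′≡0 = weighted-sum-zero (w ∘ suc) (f ∘ suc) Σw′≡0

  sum-*-sum : ∀ {n} (f g : Fin n → ℕ) → sum f * sum g ≡ sum (λ i → sum (λ j → f i * g j))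
  sum-*-sum f g = trans (*-distribʳ-sum (sum g) f) (sum-cong-≗ (λ i → *-distribˡ-sum (f i) g))

  double-sum-symmetrise : ∀ {n} (U : Fin n → Fin n → ℕ) →
    sum (λ i → sum (U i)) + sum (λ i → sum (U i)) ≡ sum (λ i → sum (λ j → U i j + U j i))
  double-sum-symmetrise U = begin
    sum (λ i → sum (U i)) + sum (λ i → sum (U i))
      ≡⟨ cong (sum (λ i → sum (U i)) +_) (∑-comm U) ⟩
    sum (λ i → sum (U i)) + sum (λ i → sum (λ j → U j i))
      ≡⟨ sym (∑-distrib-+ (λ i → sum (U i)) (λ i → sum (λ j → U j i))) ⟩
    sum (λ i → sum (U i) + sum (λ j → U j i))
      ≡⟨ sum-cong-≗ (λ i → sym (∑-distrib-+ (U i) (λ j → U j i))) ⟩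
    sum (λ i → sum (λ j → U i j + U j i)) ∎
    where open ≡-Reasoning

  rearrangement : ∀ {a b c d} → a ≤ b → c ≤ d → a * d + b * c ≤ a * c + b * d
  rearrangement {a} {b} {c} {d} a≤b c≤d with m≤n⇒∃[o]m+o≡n a≤b | m≤n⇒∃[o]m+o≡n c≤d
  ... | u , refl | v , refl = ≤-trans (m≤m+n _ (u * v)) (≤-reflexive (expand a u c v))
    where
    expand : ∀ (a u c v : ℕ) → a * (c + v) + (a + u) * c + u * v ≡ a * c + (a + u) * (c + v)
    expand = solve-∀

  half-≤ : ∀ {a b} → a + a ≤ b + b → a ≤ b
  half-≤ {a} {b} 2a≤2b with a ≤? b
  ... | yes a≤b = a≤b
  ... | no  a≰b = contradiction 2a≤2b (<⇒≱ (+-mono-< (≰⇒> a≰b) (≰⇒> a≰b)))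

  -- Proof: twice each side is a symmetrised double sum, compared termwise by
  -- the rearrangement inequality.
  chebyshev : ∀ {n} (w d : Fin n → ℕ) (F G : ℕ → ℕ) →
    (∀ {a b} → a ≤ b → F a ≤ F b) → (∀ {a b} → a ≤ b → G a ≤ G b) →
    sum (λ i → w i * F (d i)) * sum (λ i → w i * G (d i))
      ≤ sum w * sum (λ i → w i * (F (d i) * G (d i)))
  chebyshev {n} w d F G F-mono G-mono =
    half-≤ (subst₂ _≤_ (twice lhs-double) (twice rhs-double)
      (sum-mono-≤ (λ i → sum-mono-≤ (λ j → termwise i j))))
    where
    U T : Fin n → Fin n → ℕ
    U i j = w i * F (d i) * (w j * G (d j))
    T i j = w i * (w j * (F (d j) * G (d j)))

    lhs-double : sum (λ i → w i * F (d i)) * sum (λ i → w i * G (d i)) ≡ sum (λ i → sum (U i))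
    lhs-double = sum-*-sum (λ i → w i * F (d i)) (λ i → w i * G (d i))
    rhs-double : sum w * sum (λ i → w i * (F (d i) * G (d i))) ≡ sum (λ i → sum (T i))
    rhs-double = sum-*-sum w (λ i → w i * (F (d i) * G (d i)))

    twice : ∀ {a} {V : Fin n → Fin n → ℕ} → a ≡ sum (λ i → sum (V i)) →
            sum (λ i → sum (λ j → V i j + V j i)) ≡ a + a
    twice {V = V} refl = sym (double-sum-symmetrise V)

    U-sym : ∀ (wi wj fi fj gi gj : ℕ) → wi * fi * (wj * gj) + wj * fj * (wi * gi) ≡ (wi * wj) * (fi * gj + fj * gi)
    U-sym = solve-∀
    T-sym : ∀ (wi wj fi fj gi gj : ℕ) → wi * (wj * (fj * gj)) + wj * (wi * (fi * gi)) ≡ (wi * wj) * (fi * gi + fj * gj)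
    T-sym = solve-∀

    similarly-ordered : ∀ a b → F a * G b + F b * G a ≤ F a * G a + F b * G b
    similarly-ordered a b with ≤-total a b
    ... | inj₁ a≤b = rearrangement (F-mono a≤b) (G-mono a≤b)
    ... | inj₂ b≤a = subst₂ _≤_ (+-comm (F b * G a) _) (+-comm (F b * G b) _)
                       (rearrangement (F-mono b≤a) (G-mono b≤a))

    termwise : ∀ i j → U i j + U j i ≤ T i j + T j i
    termwise i j rewrite U-sym (w i) (w j) (F (d i)) (F (d j)) (G (d i)) (G (d j))
                       | T-sym (w i) (w j) (F (d i)) (F (d j)) (G (d i)) (G (d j)) =
      *-monoʳ-≤ (w i * w j) (similarly-ordered (d i) (d j))

  -- The falling factorial  k P′ t = k(k-1)⋯(k-t+1)  (zero once t > k) is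
  -- monotone in k and bounded by k^t.
  P′-monoˡ-≤ : ∀ t {a b} → a ≤ b → a P′ t ≤ b P′ t
  P′-monoˡ-≤ zero    _   = ≤-refl
  P′-monoˡ-≤ (suc t) a≤b = *-mono-≤ (∸-monoˡ-≤ t a≤b) (P′-monoˡ-≤ t a≤b)

  P′≤^ : ∀ k t → k P′ t ≤ k ^ t
  P′≤^ k zero    = ≤-refl
  P′≤^ k (suc t) = *-mono-≤ (m∸n≤m k t) (P′≤^ k t)

  P′-unfold : ∀ k t → k * ((k ∸ 1) P′ t) ≡ k P′ suc t
  P′-unfold k zero    = refl
  P′-unfold k (suc t) =
    trans (x∙yz≈y∙xz k (k ∸ 1 ∸ t) ((k ∸ 1) P′ t)) (cong₂ _*_ (∸-+-assoc k 1 t) (P′-unfold k t))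

  P′-zero : ∀ t → 0 P′ suc t ≡ 0
  P′-zero t = cong (_* (0 P′ t)) (0∸n≡0 t)

  P′-two-factors : ∀ k s → 2 ≤ s → s ≤ k → k * (k ∸ 1) ≤ k P′ s
  P′-two-factors k 1 (s≤s ()) _
  P′-two-factors k 2 _ _ = ≤-reflexive (trans (*-comm k (k ∸ 1)) (cong ((k ∸ 1) *_) (sym (*-identityʳ k))))
  P′-two-factors k (suc s@(suc (suc _))) _ s<k = ≤-trans (P′-two-factors k s (s≤s (s≤s z≤n)) (<⇒≤ s<k))
    (m≤n*m (k P′ s) (k ∸ s) {{>-nonZero (m<n⇒0<n∸m s<k)}})

  ^-distribʳ-* : ∀ a b k → (a * b) ^ k ≡ a ^ k * b ^ k
  ^-distribʳ-* a b zero    = refl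
  ^-distribʳ-* a b (suc k) = trans (cong (a * b *_) (^-distribʳ-* a b k)) (interchange a b (a ^ k) (b ^ k))

  shifted-product : ℕ → ℕ → ℕ → ℕ
  shifted-product e m zero    = 1
  shifted-product e m (suc t) = (e ∸ t * m) * shifted-product e m t

  -- If every factor satisfies e·(s'-i) ≤ s'·(e-i·m), which holds when s'·m ≤ e,
  -- then e^t · s'_t ≤ s'^t · Π_{i<t}(e - i·m).
  shifted-product-bound : ∀ t s' m e → s' * m ≤ e → e ^ t * (s' P′ t) ≤ s' ^ t * shifted-product e m t
  shifted-product-bound zero    s' m e _ = ≤-refl
  shifted-product-bound (suc t) s' m e s'm≤e = begin
    (e * e ^ t) * ((s' ∸ t) * (s' P′ t))        ≡⟨ interchange e (e ^ t) (s' ∸ t) (s' P′ t) ⟩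
    (e * (s' ∸ t)) * (e ^ t * (s' P′ t))        ≤⟨ *-mono-≤ factor (shifted-product-bound t s' m e s'm≤e) ⟩
    (s' * (e ∸ t * m)) * (s' ^ t * shifted-product e m t)
      ≡⟨ interchange s' (e ∸ t * m) (s' ^ t) (shifted-product e m t) ⟩
    (s' * s' ^ t) * ((e ∸ t * m) * shifted-product e m t) ∎
    where
    open ≤-Reasoning
    tm-side : s' * (t * m) ≤ e * t
    tm-side = subst₂ _≤_ (x∙yz≈y∙xz t s' m) (*-comm t e) (*-monoʳ-≤ t s'm≤e)
    factor : e * (s' ∸ t) ≤ s' * (e ∸ t * m)
    factor = subst₂ _≤_ (sym (*-distribˡ-∸ e s' t)) (sym (*-distribˡ-∸ s' e (t * m)))
               (subst (λ z → e * s' ∸ e * t ≤ z ∸ s' * (t * m)) (*-comm e s') (∸-monoʳ-≤ (e * s') tm-side))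

  module WeightedDegrees {n : ℕ} (w d : Fin n → ℕ) where

    m e : ℕ
    m = sum w
    e = sum (λ v → w v * d v)

    weight-nonZero : 0 < e → NonZero m
    weight-nonZero 0<e = ≢-nonZero (λ m≡0 → <⇒≢ 0<e (sym (weighted-sum-zero w d m≡0)))

    shifted-degree-sum : ∀ t → e ∸ t * m ≤ sum (λ v → w v * (d v ∸ t))
    shifted-degree-sum t = m≤n+o⇒m∸n≤o e (t * m) (subst (e ≤_) split (sum-mono-≤ pointwise))
      where
      pointwise : ∀ v → w v * d v ≤ w v * t + w v * (d v ∸ t)
      pointwise v = subst (w v * d v ≤_) (*-distribˡ-+ (w v) t (d v ∸ t)) (*-monoʳ-≤ (w v) (m≤n+m∸n (d v) t))
      split : sum (λ v → w v * t + w v * (d v ∸ t)) ≡ t * m + sum (λ v → w v * (d v ∸ t))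
      split = trans (∑-distrib-+ (λ v → w v * t) (λ v → w v * (d v ∸ t)))
                (cong (_+ sum (λ v → w v * (d v ∸ t))) (trans (sym (*-distribʳ-sum t w)) (*-comm m t)))

    -- Discrete Jensen inequality for falling factorials: the weighted mean of
    -- d_t is at least μ(μ-1)⋯(μ-t+1) with μ = e/m (denominators cleared).
    -- Induction on t, the step being Chebyshev's inequality for d ∸ t and d_t.
    falling-jensen : ∀ t → m * shifted-product e m t ≤ m ^ t * sum (λ v → w v * (d v P′ t))
    falling-jensen zero = ≤-reflexive (trans (*-identityʳ m)
      (trans (sum-cong-≗ (λ v → sym (*-identityʳ (w v)))) (sym (*-identityˡ _))))
    falling-jensen (suc t) = begin
      m * ((e ∸ t * m) * shifted-product e m t)   ≡⟨ x∙yz≈y∙xz m (e ∸ t * m) _ ⟩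
      (e ∸ t * m) * (m * shifted-product e m t)   ≤⟨ *-mono-≤ (shifted-degree-sum t) (falling-jensen t) ⟩
      lowered * (m ^ t * falling)                 ≡⟨ x∙yz≈y∙xz lowered (m ^ t) falling ⟩
      m ^ t * (lowered * falling)                 ≤⟨ *-monoʳ-≤ (m ^ t) (chebyshev w d (_∸ t) (_P′ t) (∸-monoˡ-≤ t) (P′-monoˡ-≤ t)) ⟩
      m ^ t * (m * sum (λ v → w v * (d v P′ suc t))) ≡⟨ sym (*-assoc (m ^ t) m _) ⟩
      m ^ t * m * sum (λ v → w v * (d v P′ suc t))   ≡⟨ cong (_* sum (λ v → w v * (d v P′ suc t))) (*-comm (m ^ t) m) ⟩
      m ^ suc t * sum (λ v → w v * (d v P′ suc t)) ∎
      where
      open ≤-Reasoning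
      lowered falling : ℕ
      lowered = sum (λ v → w v * (d v ∸ t))
      falling = sum (λ v → w v * (d v P′ t))

    -- Consequences of the counting hypothesis  Σ w·d_s ≤ (s'-1)·x_s  for
    -- s = r + 1 with 2 ≤ s ≤ s'.
    module _ (x s' r : ℕ) .{{_ : NonZero r}} (s≤s' : suc r ≤ s')
             (counting : sum (λ v → w v * (d v P′ suc r)) ≤ (s' ∸ 1) * (x P′ suc r)) where

      -- If the weighted degree sum exceeds s'·m, then e^s ≤ x^s·(s'm)^{s-1}:
      -- Jensen bounds Σ w·d_s below by Π_{i<s}(e - i·m), which in turn is at
      -- least (e/s')^s · s'(s'-1).
      excess-bound : s' * m < e → e ^ suc r ≤ x ^ suc r * (s' * m) ^ r
      excess-bound s'm<e = *-cancelˡ-≤ c {{c≢0}} (begin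
        c * e ^ suc r                               ≡⟨ regroup m (s' * (s' ∸ 1)) (e ^ suc r) ⟩
        m * (e ^ suc r * (s' * (s' ∸ 1)))           ≤⟨ *-monoʳ-≤ m (*-monoʳ-≤ (e ^ suc r) (P′-two-factors s' (suc r) 2≤s s≤s')) ⟩
        m * (e ^ suc r * (s' P′ suc r))             ≤⟨ *-monoʳ-≤ m (shifted-product-bound (suc r) s' m e (<⇒≤ s'm<e)) ⟩
        m * (s' ^ suc r * shifted-product e m (suc r)) ≡⟨ x∙yz≈y∙xz m (s' ^ suc r) _ ⟩
        s' ^ suc r * (m * shifted-product e m (suc r)) ≤⟨ *-monoʳ-≤ (s' ^ suc r) (falling-jensen (suc r)) ⟩
        s' ^ suc r * (m ^ suc r * sum (λ v → w v * (d v P′ suc r)))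
          ≤⟨ *-monoʳ-≤ (s' ^ suc r) (*-monoʳ-≤ (m ^ suc r) (≤-trans counting (*-monoʳ-≤ (s' ∸ 1) (P′≤^ x (suc r))))) ⟩
        s' ^ suc r * (m ^ suc r * ((s' ∸ 1) * x ^ suc r))
          ≡⟨ collect s' (s' ^ r) m (m ^ r) (s' ∸ 1) (x ^ suc r) ⟩
        c * (x ^ suc r * (s' ^ r * m ^ r))          ≡⟨ cong (λ z → c * (x ^ suc r * z)) (sym (^-distribʳ-* s' m r)) ⟩
        c * (x ^ suc r * (s' * m) ^ r) ∎)
        where
        open ≤-Reasoning
        2≤s : 2 ≤ suc r
        2≤s = s≤s (>-nonZero⁻¹ r)
        c : ℕ
        c = m * (s' * (s' ∸ 1))
        s'≥2 : 2 ≤ s'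
        s'≥2 = ≤-trans 2≤s s≤s'
        c≢0 : NonZero c
        c≢0 = m*n≢0 m (s' * (s' ∸ 1)) {{weight-nonZero (≤-<-trans z≤n s'm<e)}}
                {{m*n≢0 s' (s' ∸ 1) {{>-nonZero (≤-trans (s≤s z≤n) s'≥2)}} {{>-nonZero (m<n⇒0<n∸m s'≥2)}}}}
        regroup : ∀ a b c → a * b * c ≡ a * (c * b)
        regroup = solve-∀
        collect : ∀ s' S m M q X → (s' * S) * ((m * M) * (q * X)) ≡ m * (s' * q) * (X * (S * M))
        collect = solve-∀

      small-set-bound : x ^ suc r ≤ e → e ≤ s' * m
      small-set-bound x^s≤e with e ≤? s' * m
      ... | yes e≤s'm = e≤s'm
      ... | no  e≰s'm = contradiction (begin-strict
            e ^ suc r                    ≤⟨ excess-bound s'm<e ⟩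
            x ^ suc r * (s' * m) ^ r     ≤⟨ *-monoˡ-≤ ((s' * m) ^ r) x^s≤e ⟩
            e * (s' * m) ^ r             <⟨ *-monoʳ-< e {{>-nonZero (≤-<-trans z≤n s'm<e)}} (^-monoˡ-< r s'm<e) ⟩
            e * e ^ r ∎) (<-irrefl refl)
        where
        open ≤-Reasoning
        s'm<e : s' * m < e
        s'm<e = ≰⇒> e≰s'm

      large-set-bound : e ≤ x ^ suc r → e ^ suc r ≤ x ^ suc r * (s' * m) ^ r
      large-set-bound e≤x^s with e ≤? s' * m
      ... | yes e≤s'm = *-mono-≤ e≤x^s (^-monoˡ-≤ r e≤s'm)
      ... | no  e≰s'm = excess-bound (≰⇒> e≰s'm)

module Counting where

  open import Defs hiding (sym)
  open Inequalities using (sum-mono-≤; P′-unfold; P′-zero; module WeightedDegrees)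
  open import Data.Nat
  open import Data.Nat.Properties
  open import Data.Nat.Tactic.RingSolver using (solve-∀)
  open import Data.Nat.Combinatorics.Base using (_P′_)
  open import Data.Bool using (Bool; true; false; not; _∧_; _∨_; if_then_else_)
  open import Data.Bool.Properties using (∧-comm; ∧-identityʳ)
  open import Data.Fin using (Fin; zero; suc) renaming (_≟_ to _≟ᶠ_)
  import Data.List as List using (map; tabulate; foldr)
  import Data.Nat.ListAction as List using (sum)
  open import Data.Vec.Functional using (_∷_)
  open import Data.Product using (Σ; _×_; _,_; proj₁; proj₂)
  open import Function using (_∘_; id)
  open import Function.Definitions using (Injective)
  open import Relation.Binary.PropositionalEquality
  open import Relation.Nullary using (does; yes; no; ¬_; contradiction)
  open import Algebra.Properties.Semiring.Sum +-*-semiring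
    using (sum; sum-cong-≗; ∑-comm; *-distribˡ-sum; *-distribʳ-sum)

  𝟙 : Bool → ℕ
  𝟙 b = if b then 1 else 0

  𝟙-∧ : ∀ a b → 𝟙 (a ∧ b) ≡ 𝟙 a * 𝟙 b
  𝟙-∧ true  b = sym (*-identityˡ (𝟙 b))
  𝟙-∧ false b = refl

  ∧-swapʳ : ∀ a b c → (a ∧ b) ∧ c ≡ (a ∧ c) ∧ b
  ∧-swapʳ true  b c = ∧-comm b c
  ∧-swapʳ false b c = refl

  size : ∀ {n} → VSet n → ℕ
  size A = sum (λ v → 𝟙 (A v))

  size-cong : ∀ {n} {A B : VSet n} → (∀ v → A v ≡ B v) → size A ≡ size B
  size-cong A≗B = sum-cong-≗ (λ v → cong 𝟙 (A≗B v))

  _─_ : ∀ {n} → VSet n → Fin n → VSet n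
  (A ─ v) u = A u ∧ not (does (u ≟ᶠ v))

  ∈-─ : ∀ {n} (A : VSet n) v u → (A ─ v) u ≡ true → A u ≡ true × u ≢ v
  ∈-─ A v u u∈A─v with A u | u ≟ᶠ v
  ... | true | no u≢v = refl , u≢v

  size-─ : ∀ {n} (A : VSet n) v → A v ≡ true → size A ≡ suc (size (A ─ v))
  size-─ {suc n} A zero    Av rewrite Av = cong suc (size-cong (λ u → sym (∧-identityʳ (A (suc u)))))
  size-─ {suc n} A (suc v) Av rewrite ∧-identityʳ (A zero) | size-─ (A ∘ suc) v Av = +-suc (𝟙 (A zero)) _

  member : ∀ {n} (A : VSet n) → 0 < size A → Σ (Fin n) (λ v → A v ≡ true)
  member {suc n} A 0<|A| with A zero in A0
  ... | true  = zero , A0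
  ... | false with member (A ∘ suc) 0<|A|
  ...   | v , Av = suc v , Av

  ∷-injective : ∀ {n k} (v : Fin n) (g : Fin k → Fin n) → Injective _≡_ _≡_ g → (∀ i → g i ≢ v) →
    Injective _≡_ _≡_ (v ∷ g)
  ∷-injective v g g-inj g≢v {zero}  {zero}  _  = refl
  ∷-injective v g g-inj g≢v {zero}  {suc j} eq = contradiction (sym eq) (g≢v j)
  ∷-injective v g g-inj g≢v {suc i} {zero}  eq = contradiction eq (g≢v i)
  ∷-injective v g g-inj g≢v {suc i} {suc j} eq = cong suc (g-inj eq)

  pick : ∀ {n} k (A : VSet n) → k ≤ size A →
    Σ (Fin k → Fin n) λ b → Injective _≡_ _≡_ b × (∀ j → A (b j) ≡ true)
  pick zero    A _ = (λ ()) , (λ { {()} }) , (λ ())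
  pick (suc k) A k<|A| with member A (≤-trans (s≤s z≤n) k<|A|)
  ... | v , Av with pick k (A ─ v) (s≤s⁻¹ (subst (suc k ≤_) (size-─ A v Av) k<|A|))
  ...   | b , b-inj , b∈A─v = v ∷ b , ∷-injective v b b-inj (λ j → proj₂ (∈-─ A v (b j) (b∈A─v j))) , b∈A
    where
    b∈A : ∀ j → A ((v ∷ b) j) ≡ true
    b∈A zero    = Av
    b∈A (suc j) = proj₁ (∈-─ A v (b j) (b∈A─v j))

  -- The number of injective t-tuples with entries in A, enumerated by first entry.
  tuples : ∀ {n} → VSet n → ℕ → ℕ
  tuples A zero    = 1
  tuples A (suc t) = sum (λ v → 𝟙 (A v) * tuples (A ─ v) t)

  tuples≡P′ : ∀ {n} t (A : VSet n) → tuples A t ≡ size A P′ t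
  tuples≡P′ zero    A = refl
  tuples≡P′ (suc t) A = begin
    sum (λ v → 𝟙 (A v) * tuples (A ─ v) t)      ≡⟨ sum-cong-≗ first-entry ⟩
    sum (λ v → 𝟙 (A v) * ((size A ∸ 1) P′ t))   ≡⟨ *-distribʳ-sum ((size A ∸ 1) P′ t) (λ v → 𝟙 (A v)) ⟨
    size A * ((size A ∸ 1) P′ t)                ≡⟨ P′-unfold (size A) t ⟩
    size A P′ suc t ∎
    where
    open ≡-Reasoning
    first-entry : ∀ v → 𝟙 (A v) * tuples (A ─ v) t ≡ 𝟙 (A v) * ((size A ∸ 1) P′ t)
    first-entry v with A v in Av
    ... | false = refl
    ... | true rewrite tuples≡P′ t (A ─ v) | size-─ A v Av = refl

  tuples-cong : ∀ {n} t {A B : VSet n} → (∀ u → A u ≡ B u) → tuples A t ≡ tuples B t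
  tuples-cong t {A} {B} A≗B =
    trans (tuples≡P′ t A) (trans (cong (_P′ t) (size-cong A≗B)) (sym (tuples≡P′ t B)))

  module CommonNeighbours {n : ℕ} (G : Graph n) where

    -- The members of C adjacent to a, and the members of A adjacent to y
    -- (adjacency always read from the A-side vertex).
    N⁺ : Fin n → VSet n → VSet n
    N⁺ a C y = C y ∧ adj G a y

    N⁻ : Fin n → VSet n → VSet n
    N⁻ y A u = A u ∧ adj G u y

    -- The sum, over injective t-tuples (a₁,…,a_t) in A, of the number of
    -- common neighbours of a₁,…,a_t in C.
    common : VSet n → VSet n → ℕ → ℕ
    common A C zero    = size C
    common A C (suc t) = sum (λ a → 𝟙 (A a) * common (A ─ a) (N⁺ a C) t)

    -- Double counting the pairs (tuple, common neighbour) by the neighbour: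
    -- each y ∈ C contributes the injective t-tuples in A ∩ N(y).
    double-count : ∀ t A C → sum (λ y → 𝟙 (C y) * tuples (N⁻ y A) t) ≡ common A C t
    double-count zero    A C = sum-cong-≗ (λ y → *-identityʳ (𝟙 (C y)))
    double-count (suc t) A C = begin
      sum (λ y → 𝟙 (C y) * sum (λ a → 𝟙 (N⁻ y A a) * tuples (N⁻ y A ─ a) t))
        ≡⟨ sum-cong-≗ (λ y → *-distribˡ-sum {n} (𝟙 (C y)) _) ⟩
      sum (λ y → sum (λ a → 𝟙 (C y) * (𝟙 (N⁻ y A a) * tuples (N⁻ y A ─ a) t)))
        ≡⟨ ∑-comm {n} {n} _ ⟩
      sum (λ a → sum (λ y → 𝟙 (C y) * (𝟙 (N⁻ y A a) * tuples (N⁻ y A ─ a) t)))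
        ≡⟨ sum-cong-≗ (λ a → sum-cong-≗ (λ y → exchange a y)) ⟩
      sum (λ a → sum (λ y → 𝟙 (A a) * (𝟙 (N⁺ a C y) * tuples (N⁻ y (A ─ a)) t)))
        ≡⟨ sum-cong-≗ (λ a → *-distribˡ-sum {n} (𝟙 (A a)) _) ⟨
      sum (λ a → 𝟙 (A a) * sum (λ y → 𝟙 (N⁺ a C y) * tuples (N⁻ y (A ─ a)) t))
        ≡⟨ sum-cong-≗ (λ a → cong (𝟙 (A a) *_) (double-count t (A ─ a) (N⁺ a C))) ⟩
      sum (λ a → 𝟙 (A a) * common (A ─ a) (N⁺ a C) t) ∎
      where
      open ≡-Reasoning
      regroup : ∀ c a b k → c * (a * b * k) ≡ a * (c * b * k)
      regroup = solve-∀
      exchange : ∀ a y → 𝟙 (C y) * (𝟙 (N⁻ y A a) * tuples (N⁻ y A ─ a) t)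
                       ≡ 𝟙 (A a) * (𝟙 (N⁺ a C y) * tuples (N⁻ y (A ─ a)) t)
      exchange a y
        rewrite tuples-cong t (λ u → ∧-swapʳ (A u) (adj G u y) (not (does (u ≟ᶠ a))))
              | 𝟙-∧ (A a) (adj G a y) | 𝟙-∧ (C y) (adj G a y) =
        regroup (𝟙 (C y)) (𝟙 (A a)) (𝟙 (adj G a y)) _

    record Biclique (A C : VSet n) (t s' : ℕ) : Set where
      field
        left            : Fin t → Fin n
        right           : Fin s' → Fin n
        left-injective  : Injective _≡_ _≡_ left
        right-injective : Injective _≡_ _≡_ right
        left-in         : ∀ i → A (left i) ≡ true
        right-in        : ∀ j → C (right j) ≡ true
        complete        : ∀ i j → adj G (left i) (right j) ≡ true

    biclique-base : ∀ {A C s'} → s' ≤ size C → Biclique A C 0 s'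
    biclique-base {C = C} {s'} s'≤|C| with pick s' C s'≤|C|
    ... | b , b-inj , b∈C = record
      { left = λ () ; right = b ; left-injective = λ { {()} } ; right-injective = b-inj
      ; left-in = λ () ; right-in = b∈C ; complete = λ () }

    biclique-extend : ∀ {A C t s'} a → A a ≡ true → Biclique (A ─ a) (N⁺ a C) t s' → Biclique A C (suc t) s'
    biclique-extend {A} {C} a Aa K = record
      { left = a ∷ left ; right = right
      ; left-injective = ∷-injective a left left-injective (λ i → proj₂ (∈-─ A a (left i) (left-in i)))
      ; right-injective = right-injective
      ; left-in = a∷left-in ; right-in = λ j → ∧-true₁ (right-in j) ; complete = a∷left-complete }
      where
      open Biclique K
      ∧-true₁ : ∀ {p q} → (p ∧ q) ≡ true → p ≡ true
      ∧-true₁ {true} _ = refl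
      ∧-true₂ : ∀ {p q} → (p ∧ q) ≡ true → q ≡ true
      ∧-true₂ {true} q≡true = q≡true
      a∷left-in : ∀ i → A ((a ∷ left) i) ≡ true
      a∷left-in zero    = Aa
      a∷left-in (suc i) = proj₁ (∈-─ A a (left i) (left-in i))
      a∷left-complete : ∀ i j → adj G ((a ∷ left) i) (right j) ≡ true
      a∷left-complete zero    j = ∧-true₂ {C (right j)} (right-in j)
      a∷left-complete (suc i) j = complete i j

    common-bound : ∀ {s'} t A C → ¬ Biclique A C t s' → common A C t ≤ (s' ∸ 1) * tuples A t
    common-bound {s'} zero A C no-K with size C ≤? s' ∸ 1
    ... | yes |C|<s' = subst (size C ≤_) (sym (*-identityʳ (s' ∸ 1))) |C|<s'
    ... | no  |C|≮s' = contradiction (biclique-base (≤-trans (m≤n+m∸n s' 1) (≰⇒> |C|≮s'))) no-K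
    common-bound {s'} (suc t) A C no-K = begin
      sum (λ a → 𝟙 (A a) * common (A ─ a) (N⁺ a C) t)   ≤⟨ sum-mono-≤ first-entry ⟩
      sum (λ a → (s' ∸ 1) * (𝟙 (A a) * tuples (A ─ a) t)) ≡⟨ *-distribˡ-sum {n} (s' ∸ 1) _ ⟨
      (s' ∸ 1) * tuples A (suc t) ∎
      where
      open ≤-Reasoning
      first-entry : ∀ a → 𝟙 (A a) * common (A ─ a) (N⁺ a C) t ≤ (s' ∸ 1) * (𝟙 (A a) * tuples (A ─ a) t)
      first-entry a with A a in Aa
      ... | false = z≤n
      ... | true  = subst₂ _≤_ (sym (*-identityˡ _)) (cong ((s' ∸ 1) *_) (sym (*-identityˡ _)))
                      (common-bound t (A ─ a) (N⁺ a C) (no-K ∘ biclique-extend a Aa))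

  sum-tabulate : ∀ {n k} (f : Fin n → ℕ) (g : Fin k → Fin n) →
    List.sum (List.map f (List.tabulate g)) ≡ sum (f ∘ g)
  sum-tabulate {k = zero}  f g = refl
  sum-tabulate {k = suc k} f g = cong (f (g zero) +_) (sum-tabulate f (g ∘ suc))

  count≡size : ∀ {n} (A : VSet n) → count A ≡ size A
  count≡size A = sum-tabulate (λ v → 𝟙 (A v)) id

  none-satisfies : ∀ {n k} (p : Fin n → Bool) (g : Fin k → Fin n) →
    List.foldr (λ v b → p v ∨ b) false (List.tabulate g) ≡ false → sum (λ i → 𝟙 (p (g i))) ≡ 0
  none-satisfies {k = zero}  p g _ = refl
  none-satisfies {k = suc k} p g none with p (g zero) | none
  ... | false | none′ = none-satisfies p (g ∘ suc) none′

  module Neighbourhood {n : ℕ} (G : Graph n) (X : VSet n) where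
    open CommonNeighbours G

    deg : Fin n → ℕ
    deg y = size (N⁻ y X)

    inN : Fin n → ℕ
    inN y = 𝟙 (Nbhd G X y)

    -- A vertex outside X but not in N(X) has degree 0, so a quantity vanishing
    -- at degree 0 may be summed over N(X) instead of over V ∖ X.
    outside≡inN : (h : ℕ → ℕ) → h 0 ≡ 0 → ∀ y → 𝟙 (not (X y)) * h (deg y) ≡ inN y * h (deg y)
    outside≡inN h h0≡0 y with X y
    ... | true  = refl
    ... | false with anyV (λ u → X u ∧ adj G u y) in no-nbr
    ...   | true  = refl
    ...   | false rewrite none-satisfies (λ u → X u ∧ adj G u y) id no-nbr | h0≡0 = refl

    eOut≡ : eOut G X ≡ sum (λ y → inN y * deg y)
    eOut≡ = begin
      eOut G X
        ≡⟨ sum-tabulate (λ u → count (λ v → X u ∧ (not (X v) ∧ adj G u v))) id ⟩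
      sum (λ u → count (λ v → X u ∧ (not (X v) ∧ adj G u v)))
        ≡⟨ sum-cong-≗ (λ u → count≡size (λ v → X u ∧ (not (X v) ∧ adj G u v))) ⟩
      sum (λ u → sum (λ v → 𝟙 (X u ∧ (not (X v) ∧ adj G u v))))
        ≡⟨ ∑-comm {n} {n} _ ⟩
      sum (λ v → sum (λ u → 𝟙 (X u ∧ (not (X v) ∧ adj G u v))))
        ≡⟨ sum-cong-≗ (λ v → trans (sum-cong-≗ (λ u → split (X u) (not (X v)) (adj G u v)))
                                   (sym (*-distribˡ-sum {n} (𝟙 (not (X v))) _))) ⟩
      sum (λ v → 𝟙 (not (X v)) * deg v)
        ≡⟨ sum-cong-≗ (outside≡inN id refl) ⟩
      sum (λ y → inN y * deg y) ∎
      where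
      open ≡-Reasoning
      split : ∀ a b c → 𝟙 (a ∧ (b ∧ c)) ≡ 𝟙 b * 𝟙 (a ∧ c)
      split true  b c = 𝟙-∧ b c
      split false b c = sym (*-zeroʳ (𝟙 b))

    biclique⇒Kss : ∀ {s s'} → Biclique X (not ∘ X) s s' → ContainsKss G s s'
    biclique⇒Kss K = left , right , left-injective , right-injective , disjoint , complete
      where
      open Biclique K
      disjoint : ∀ i j → left i ≢ right j
      disjoint i j l≡r with X (right j) | right-in j | trans (sym (left-in i)) (cong X l≡r)
      ... | false | _ | ()

    kss-count : ∀ s' r → KssFree G (suc r) s' → sum (λ y → inN y * (deg y P′ suc r)) ≤ (s' ∸ 1) * (size X P′ suc r)
    kss-count s' r free = begin
      sum (λ y → inN y * (deg y P′ suc r))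
        ≡⟨ sum-cong-≗ (λ y → trans (sym (outside≡inN (_P′ suc r) (P′-zero r) y))
                                   (cong (𝟙 (not (X y)) *_) (sym (tuples≡P′ (suc r) (N⁻ y X))))) ⟩
      sum (λ y → 𝟙 (not (X y)) * tuples (N⁻ y X) (suc r)) ≡⟨ double-count (suc r) X (not ∘ X) ⟩
      common X (not ∘ X) (suc r)                         ≤⟨ common-bound (suc r) X (not ∘ X) (free ∘ biclique⇒Kss) ⟩
      (s' ∸ 1) * tuples X (suc r)                        ≡⟨ cong ((s' ∸ 1) *_) (tuples≡P′ (suc r) X) ⟩
      (s' ∸ 1) * (size X P′ suc r) ∎
      where open ≤-Reasoning

    module _ (s' r : ℕ) .{{_ : NonZero r}} (s≤s' : suc r ≤ s') (free : KssFree G (suc r) s') where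
      open WeightedDegrees inN deg

      small-set-expansion : card X ^ suc r ≤ eOut G X → eOut G X ≤ s' * card (Nbhd G X)
      small-set-expansion rewrite count≡size X | eOut≡ | count≡size (Nbhd G X) =
        small-set-bound (size X) s' r s≤s' (kss-count s' r free)

      large-set-expansion : eOut G X ≤ card X ^ suc r → eOut G X ^ suc r ≤ card X ^ suc r * (s' * card (Nbhd G X)) ^ r
      large-set-expansion rewrite count≡size X | eOut≡ | count≡size (Nbhd G X) =
        large-set-bound (size X) s' r s≤s' (kss-count s' r free)

module Rationals where

  open import Defs hiding (sym)
  open import Data.Nat as ℕ using (ℕ; zero; suc)
  import Data.Nat.Properties as ℕ
  import Data.Integer as ℤ
  import Data.Integer.Properties as ℤ
  open import Data.Nat.Coprimality using (1-coprimeTo) renaming (sym to coprime-sym)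
  open import Data.Rational
  open import Data.Rational.Properties
  import Data.Rational.Unnormalised as ℚᵘ
  import Data.Rational.Unnormalised.Properties as ℚᵘ
  open import Relation.Binary.PropositionalEquality
  open import Relation.Nullary using (yes; no; contradiction)
  open import Algebra.Bundles using (CommutativeRing)
  open import Algebra.Properties.CommutativeSemigroup
    (CommutativeRing.*-commutativeSemigroup +-*-commutativeRing) using (interchange)

  -- The embedding ℕ → ℚ: ℕ→ℚ a is the normal form a/1, which makes it an
  -- order embedding and a multiplicative homomorphism.
  private
    a/1 : ℕ → ℚ
    a/1 a = mkℚ (ℤ.+ a) 0 (coprime-sym (1-coprimeTo a))

    ℕ→ℚ≡a/1 : ∀ a → ℕ→ℚ a ≡ a/1 a
    ℕ→ℚ≡a/1 a = ↥p/↧p≡p (a/1 a)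

    ×1 : ∀ a → ℤ.+ a ℤ.* ℤ.+ 1 ≡ ℤ.+ a
    ×1 a = ℤ.*-identityʳ (ℤ.+ a)

  ℕ→ℚ-mono-≤ : ∀ {a b} → a ℕ.≤ b → ℕ→ℚ a ≤ ℕ→ℚ b
  ℕ→ℚ-mono-≤ {a} {b} a≤b rewrite ℕ→ℚ≡a/1 a | ℕ→ℚ≡a/1 b =
    *≤* (subst₂ ℤ._≤_ (sym (×1 a)) (sym (×1 b)) (ℤ.+≤+ a≤b))

  ℕ→ℚ-cancel-≤ : ∀ {a b} → ℕ→ℚ a ≤ ℕ→ℚ b → a ℕ.≤ b
  ℕ→ℚ-cancel-≤ {a} {b} A≤B rewrite ℕ→ℚ≡a/1 a | ℕ→ℚ≡a/1 b with A≤B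
  ... | *≤* a≤b = ℤ.drop‿+≤+ (subst₂ ℤ._≤_ (×1 a) (×1 b) a≤b)

  ℕ→ℚ-mono-< : ∀ {a b} → a ℕ.< b → ℕ→ℚ a < ℕ→ℚ b
  ℕ→ℚ-mono-< {a} {b} a<b rewrite ℕ→ℚ≡a/1 a | ℕ→ℚ≡a/1 b =
    *<* (subst₂ ℤ._<_ (sym (×1 a)) (sym (×1 b)) (ℤ.+<+ a<b))

  ℕ→ℚ-homo-* : ∀ a b → ℕ→ℚ (a ℕ.* b) ≡ ℕ→ℚ a * ℕ→ℚ b
  ℕ→ℚ-homo-* a b rewrite ℕ→ℚ≡a/1 a | ℕ→ℚ≡a/1 b | ℕ→ℚ≡a/1 (a ℕ.* b) =
    toℚᵘ-injective (ℚᵘ.≃-trans (ℚᵘ.*≡* (cong (ℤ._* ℤ.+ 1) (ℤ.pos-* a b)))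
                               (ℚᵘ.≃-sym (toℚᵘ-homo-* (a/1 a) (a/1 b))))

  ℕ→ℚ-homo-^ : ∀ a k → ℕ→ℚ (a ℕ.^ k) ≡ ℕ→ℚ a ^ℚ k
  ℕ→ℚ-homo-^ a zero    = refl
  ℕ→ℚ-homo-^ a (suc k) = trans (ℕ→ℚ-homo-* a (a ℕ.^ k)) (cong (ℕ→ℚ a *_) (ℕ→ℚ-homo-^ a k))

  ℕ→ℚ-nonNeg : ∀ a → NonNegative (ℕ→ℚ a)
  ℕ→ℚ-nonNeg a = nonNegative (ℕ→ℚ-mono-≤ {0} {a} ℕ.z≤n)

  ^ℚ-distrib-* : ∀ p q k → (p * q) ^ℚ k ≡ p ^ℚ k * q ^ℚ k
  ^ℚ-distrib-* p q zero    = refl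
  ^ℚ-distrib-* p q (suc k) = trans (cong (p * q *_) (^ℚ-distrib-* p q k)) (interchange p q (p ^ℚ k) (q ^ℚ k))

  ^ℚ-pos : ∀ {p} k → 0ℚ < p → 0ℚ < p ^ℚ k
  ^ℚ-pos zero    _   = *<* (ℤ.+<+ (ℕ.s≤s ℕ.z≤n))
  ^ℚ-pos {p} (suc k) 0<p = positive⁻¹ (p * p ^ℚ k)
    {{pos*pos⇒pos p {{positive 0<p}} (p ^ℚ k) {{positive (^ℚ-pos k 0<p)}}}}

  ^ℚ-mono-≤ : ∀ {p q} k → 0ℚ < p → p ≤ q → p ^ℚ k ≤ q ^ℚ k
  ^ℚ-mono-≤ zero    _   _   = ≤-refl
  ^ℚ-mono-≤ {p} {q} (suc k) 0<p p≤q = ≤-trans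
    (*-monoʳ-≤-nonNeg (p ^ℚ k) {{pos⇒nonNeg (p ^ℚ k) {{positive (^ℚ-pos k 0<p)}}}} p≤q)
    (*-monoˡ-≤-nonNeg q {{pos⇒nonNeg q {{positive (<-≤-trans 0<p p≤q)}}}} (^ℚ-mono-≤ k 0<p p≤q))

  positive-base : ∀ x r .{{_ : ℕ.NonZero r}} {d} → 0ℚ < d → d < ℕ→ℚ x ^ℚ r → 0 ℕ.< x
  positive-base (suc _) _       _   _      = ℕ.s≤s ℕ.z≤n
  positive-base zero    (suc r) 0<d d<0^r =
    contradiction (subst (_ <_) (*-zeroˡ (ℕ→ℚ 0 ^ℚ r)) d<0^r) (<-asym 0<d)

  swap-exponents : ∀ a j k → (a ℕ.^ j) ℕ.^ k ≡ (a ℕ.^ k) ℕ.^ j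
  swap-exponents a j k =
    trans (ℕ.^-*-assoc a j k) (trans (cong (a ℕ.^_) (ℕ.*-comm j k)) (sym (ℕ.^-*-assoc a k j)))

  module _ (x e m s' r : ℕ) where
    private
      X E S'M : ℚ
      X   = ℕ→ℚ x
      E   = ℕ→ℚ e
      S'M = ℕ→ℚ s' * ℕ→ℚ m

      E≤S'M : e ℕ.≤ s' ℕ.* m → E ≤ S'M
      E≤S'M e≤s'm = subst (E ≤_) (ℕ→ℚ-homo-* s' m) (ℕ→ℚ-mono-≤ e≤s'm)

    -- If |X|^{s-1} ≤ d, then x^s ≤ d·x ≤ e, so the small-set case applies.
    linear-case : (x ℕ.^ suc r ℕ.≤ e → e ℕ.≤ s' ℕ.* m) →
      (d : ℚ) → d * X ≤ E → X ^ℚ r ≤ d → d * X ≤ S'M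
    linear-case small-case d dX≤E X^r≤d = ≤-trans dX≤E (E≤S'M (small-case (ℕ→ℚ-cancel-≤ X^s≤E)))
      where
      open ≤-Reasoning
      X^s≤E : ℕ→ℚ (x ℕ.^ suc r) ≤ E
      X^s≤E = begin
        ℕ→ℚ (x ℕ.^ suc r) ≡⟨ ℕ→ℚ-homo-^ x (suc r) ⟩
        X * X ^ℚ r         ≤⟨ *-monoˡ-≤-nonNeg X {{ℕ→ℚ-nonNeg x}} X^r≤d ⟩
        X * d              ≡⟨ *-comm X d ⟩
        d * X              ≤⟨ dX≤E ⟩
        E ∎

    -- If d < |X|^{s-1}: when x^s ≤ e we are in the small-set case and
    -- d^s ≤ (x^s)^{s-1} ≤ (s'm)^{s-1}; otherwise (d·x)^s ≤ e^s ≤ x^s (s'm)^{s-1}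
    -- and x^s cancels.
    power-case : .{{_ : ℕ.NonZero r}} →
      (x ℕ.^ suc r ℕ.≤ e → e ℕ.≤ s' ℕ.* m) →
      (e ℕ.≤ x ℕ.^ suc r → e ℕ.^ suc r ℕ.≤ x ℕ.^ suc r ℕ.* (s' ℕ.* m) ℕ.^ r) →
      (d : ℚ) → 0ℚ < d → d * X ≤ E → d < X ^ℚ r → d ^ℚ suc r ≤ S'M ^ℚ r
    power-case small-case large-case d 0<d dX≤E d<X^r with x ℕ.^ suc r ℕ.≤? e
    ... | yes x^s≤e = begin
      d ^ℚ suc r                    ≤⟨ ^ℚ-mono-≤ (suc r) 0<d (<⇒≤ d<X^r) ⟩
      (X ^ℚ r) ^ℚ suc r             ≡⟨ cast-power-of-power ⟩
      ℕ→ℚ ((x ℕ.^ suc r) ℕ.^ r)     ≤⟨ ℕ→ℚ-mono-≤ (ℕ.^-monoˡ-≤ r (ℕ.≤-trans x^s≤e (small-case x^s≤e))) ⟩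
      ℕ→ℚ ((s' ℕ.* m) ℕ.^ r)        ≡⟨ trans (ℕ→ℚ-homo-^ (s' ℕ.* m) r) (cong (_^ℚ r) (ℕ→ℚ-homo-* s' m)) ⟩
      S'M ^ℚ r ∎
      where
      open ≤-Reasoning
      cast-power-of-power : (X ^ℚ r) ^ℚ suc r ≡ ℕ→ℚ ((x ℕ.^ suc r) ℕ.^ r)
      cast-power-of-power = begin-equality
        (X ^ℚ r) ^ℚ suc r           ≡⟨ cong (_^ℚ suc r) (ℕ→ℚ-homo-^ x r) ⟨
        ℕ→ℚ (x ℕ.^ r) ^ℚ suc r      ≡⟨ ℕ→ℚ-homo-^ (x ℕ.^ r) (suc r) ⟨
        ℕ→ℚ ((x ℕ.^ r) ℕ.^ suc r)   ≡⟨ cong ℕ→ℚ (swap-exponents x r (suc r)) ⟩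
        ℕ→ℚ ((x ℕ.^ suc r) ℕ.^ r) ∎
    ... | no  x^s≰e = *-cancelʳ-≤-pos (X ^ℚ suc r) {{positive (^ℚ-pos (suc r) 0<X)}} (begin
      d ^ℚ suc r * X ^ℚ suc r       ≡⟨ ^ℚ-distrib-* d X (suc r) ⟨
      (d * X) ^ℚ suc r              ≤⟨ ^ℚ-mono-≤ (suc r) 0<dX dX≤E ⟩
      E ^ℚ suc r                    ≡⟨ ℕ→ℚ-homo-^ e (suc r) ⟨
      ℕ→ℚ (e ℕ.^ suc r)             ≤⟨ ℕ→ℚ-mono-≤ (large-case (ℕ.<⇒≤ (ℕ.≰⇒> x^s≰e))) ⟩
      ℕ→ℚ (x ℕ.^ suc r ℕ.* (s' ℕ.* m) ℕ.^ r)
        ≡⟨ trans (ℕ→ℚ-homo-* (x ℕ.^ suc r) _)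
                 (cong₂ _*_ (ℕ→ℚ-homo-^ x (suc r))
                            (trans (ℕ→ℚ-homo-^ (s' ℕ.* m) r) (cong (_^ℚ r) (ℕ→ℚ-homo-* s' m)))) ⟩
      X ^ℚ suc r * S'M ^ℚ r         ≡⟨ *-comm (X ^ℚ suc r) (S'M ^ℚ r) ⟩
      S'M ^ℚ r * X ^ℚ suc r ∎)
      where
      open ≤-Reasoning
      0<X : 0ℚ < X
      0<X = ℕ→ℚ-mono-< (positive-base x r 0<d d<X^r)
      0<dX : 0ℚ < d * X
      0<dX = positive⁻¹ (d * X) {{pos*pos⇒pos d {{positive 0<d}} X {{positive 0<X}}}}

open import Defs
open Counting using (module Neighbourhood)
open Rationals using (linear-case; power-case)
open import Data.Nat using (ℕ; _≤_; _∸_; suc; s≤s; _^_; NonZero; >-nonZero)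
import Data.Nat as ℕ
open import Data.Product using (_×_; _,_)
open import Data.Rational using (ℚ; 0ℚ; _*_) renaming (_≤_ to _≤ℚ_; _<_ to _<ℚ_)

lemma7p2 : (s s' n : ℕ) → 2 ≤ s → s ≤ s' →
    (G : Graph n) → KssFree G s s' →
    (X : VSet n) → (d : ℚ) → 0ℚ <ℚ d →
    d * ℕ→ℚ (card X) ≤ℚ ℕ→ℚ (eOut G X) →
    -- case |X| ≤ d^{1/(s-1)}, i.e. |X|^{s-1} ≤ d : |N(X)| ≥ d|X|/s'
    ((ℕ→ℚ (card X) ^ℚ (s ∸ 1) ≤ℚ d →
        d * ℕ→ℚ (card X) ≤ℚ ℕ→ℚ s' * ℕ→ℚ (card (Nbhd G X)))
    -- otherwise: |N(X)| ≥ d^{s/(s-1)}/s', i.e. d^s ≤ (s'|N(X)|)^{s-1}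
    × (d <ℚ ℕ→ℚ (card X) ^ℚ (s ∸ 1) →
        d ^ℚ s ≤ℚ (ℕ→ℚ s' * ℕ→ℚ (card (Nbhd G X))) ^ℚ (s ∸ 1)))
lemma7p2 (suc r) s' n (s≤s 1≤r) s≤s' G free X d 0<d dX≤E =
    linear-case x e m s' r small d dX≤E
  , power-case x e m s' r small large d 0<d dX≤E
  where
  instance
    r≢0 : NonZero r
    r≢0 = >-nonZero 1≤r
  open Neighbourhood G X
  x e m : ℕ
  x = card X
  e = eOut G X
  m = card (Nbhd G X)
  small : x ^ suc r ≤ e → e ≤ s' ℕ.* m
  small = small-set-expansion s' r s≤s' free
  large : e ≤ x ^ suc r → e ^ suc r ≤ x ^ suc r ℕ.* (s' ℕ.* m) ^ r
  large = large-set-expansion s' r s≤s' free
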